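{- Let $k\ge2$ and let $M=\{\{i_1,j_1\},\dots,\{i_k,j_k\}\}$ be a perfect matching of $[2k]$ with $i_1<\dots<i_k$ and $i_t<j_t$ for all $t$. Let $\sigma_M\in S_{2k}$ be given by $\sigma_M(2t-1)=i_t$, $\sigma_M(2t)=j_t$, let $\tau_M=(i_1,j_1)(i_2,j_2)\cdots(i_k,j_k)$, let $I_M=\{(i,j):1\le i<j\le2k,\ \sigma_M(i)>\sigma_M(j)\}$ and $D_M=\{(i,j):1\le i<j\le2k,\ \tau_M(i)>j,\ \tau_M(j)>i\}$. Then $\psi_M(i,j)=(\tau_M\sigma_M(i),\sigma_M(j))$ defines a bijection $\psi_M:I_M\to D_M$. -}

module Defs where

open import Data.Nat using (ℕ; zero; suc; _+_; _*_; _≤_; _<_; _≡ᵇ_)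
open import Data.Bool using (if_then_else_)
open import Data.Product using (_×_; _,_; ∃-syntax)
open import Data.Sum using (_⊎_)
open import Relation.Binary.PropositionalEquality using (_≡_; _≢_)

-- Conventions: everything is 1-indexed as in the paper.  A perfect matching
-- M = {{i_1,j_1},…,{i_k,j_k}} of [2k] = {1,…,2k}, listed with i_1<…<i_k and
-- i_t<j_t, is given by two functions i j : ℕ → ℕ; only their values at
-- t ∈ {1,…,k} are relevant.

record IsSortedPerfectMatching (k : ℕ) (i j : ℕ → ℕ) : Set where
  field
    bounds     : ∀ t → 1 ≤ t → t ≤ k → 1 ≤ i t × i t < j t × j t ≤ 2 * k
    increasing : ∀ s t → 1 ≤ s → t ≤ k → s < t → i s < i t
    disjoint-ij : ∀ s t → 1 ≤ s → s ≤ k → 1 ≤ t → t ≤ k → i s ≢ j t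
    disjoint-jj : ∀ s t → 1 ≤ s → s ≤ k → 1 ≤ t → t ≤ k → s ≢ t → j s ≢ j t
    covering   : ∀ x → 1 ≤ x → x ≤ 2 * k →
                 ∃[ t ] (1 ≤ t × t ≤ k × (x ≡ i t ⊎ x ≡ j t))

-- σ_M(2t-1) = i_t, σ_M(2t) = j_t   (value at 0 is irrelevant)
σM : (ℕ → ℕ) → (ℕ → ℕ) → ℕ → ℕ
σM i j zero = zero
σM i j (suc zero) = i 1
σM i j (suc (suc zero)) = j 1
σM i j (suc (suc (suc n))) = σM (λ t → i (suc t)) (λ t → j (suc t)) (suc n)

τM : ℕ → (ℕ → ℕ) → (ℕ → ℕ) → ℕ → ℕ
τM zero i j x = x
τM (suc k) i j x =
  if x ≡ᵇ i (suc k) then j (suc k)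
  else (if x ≡ᵇ j (suc k) then i (suc k) else τM k i j x)

InI : ℕ → (ℕ → ℕ) → (ℕ → ℕ) → ℕ → ℕ → Set
InI k i j a b = 1 ≤ a × a < b × b ≤ 2 * k × σM i j b < σM i j a

InD : ℕ → (ℕ → ℕ) → (ℕ → ℕ) → ℕ → ℕ → Set
InD k i j a b = 1 ≤ a × a < b × b ≤ 2 * k × b < τM k i j a × a < τM k i j b

ψM : ℕ → (ℕ → ℕ) → (ℕ → ℕ) → ℕ × ℕ → ℕ × ℕ
ψM k i j (a , b) = (τM k i j (σM i j a) , σM i j b)

{-# OPTIONS --safe #-}
module Submission where

-- Write position 2s+1 of [2k] as slot s false and 2s+2 as slot s true, so that
-- σ_M sends them to i_{s+1} and j_{s+1} (entry s false, entry s true), while τ_M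
-- swaps the two elements of each pair.  An inversion (a, b) of σ_M must have
-- a = slot s true (i_{s+1} lies below everything σ_M puts after it) and
-- b = slot t q with s < t and σ_M b < j_{s+1}.  Dually an element of D_M must be
-- (i_{s+1}, x) with x from a later pair t and x < j_{s+1}.  So both sets are
-- parametrised by the same triples (s, t, q), and ψ_M maps one parametrisation
-- onto the other.

open import Defs
open import Data.Bool using (Bool; true; false; not)
open import Data.Empty using (⊥-elim)
open import Data.Nat using (ℕ; zero; suc; _*_; _≤_; _<_; _≟_; z≤n; s≤s; s≤s⁻¹)
open import Data.Nat.Properties
open import Data.Product using (_×_; _,_; ∃-syntax; proj₁; proj₂; uncurry)
open import Data.Sum using (_⊎_; inj₁; inj₂)
open import Function using (_∘_)
open import Relation.Binary.Definitions using (tri<; tri≈; tri>)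
open import Relation.Binary.PropositionalEquality
open import Relation.Nullary using (¬_; yes; no)
open import Relation.Nullary.Decidable using (dec-true; dec-false)

slot : ℕ → Bool → ℕ
slot s false = suc (2 * s)
slot s true  = suc (suc (2 * s))

slot-suc : ∀ s p → slot (suc s) p ≡ suc (suc (slot s p))
slot-suc s false = cong suc (*-suc 2 s)
slot-suc s true  = cong (λ n → suc (suc n)) (*-suc 2 s)

slot≤2*suc : ∀ s p → slot s p ≤ 2 * suc s
slot≤2*suc s false = subst (suc (2 * s) ≤_) (sym (*-suc 2 s)) (n≤1+n _)
slot≤2*suc s true  = ≤-reflexive (sym (*-suc 2 s))

slot-false≤slot : ∀ s p → slot s false ≤ slot s p
slot-false≤slot s false = ≤-refl
slot-false≤slot s true  = n≤1+n _

slot-<-mono : ∀ {s t} p q → s < t → slot s p < slot t q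
slot-<-mono {s} {t} p q s<t = begin-strict
  slot s p     ≤⟨ slot≤2*suc s p ⟩
  2 * suc s    ≤⟨ *-monoʳ-≤ 2 s<t ⟩
  2 * t        <⟨ n<1+n (2 * t) ⟩
  slot t false ≤⟨ slot-false≤slot t q ⟩
  slot t q     ∎
  where open ≤-Reasoning

slot-<⁻¹ : ∀ {s t} p q → slot s p < slot t q → s < t ⊎ (s ≡ t × p ≡ false × q ≡ true)
slot-<⁻¹ {s} {t} p q lt with <-cmp s t
... | tri< s<t _ _ = inj₁ s<t
... | tri> _ _ t<s = ⊥-elim (<-asym lt (slot-<-mono q p t<s))
slot-<⁻¹ false false lt | tri≈ _ refl _ = ⊥-elim (<-irrefl refl lt)
slot-<⁻¹ false true  lt | tri≈ _ refl _ = inj₂ (refl , refl , refl)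
slot-<⁻¹ true  false lt | tri≈ _ refl _ = ⊥-elim (<-asym lt (n<1+n _))
slot-<⁻¹ true  true  lt | tri≈ _ refl _ = ⊥-elim (<-irrefl refl lt)

<⇒slot≤2* : ∀ {s k} p → s < k → slot s p ≤ 2 * k
<⇒slot≤2* {s} p s<k = ≤-trans (slot≤2*suc s p) (*-monoʳ-≤ 2 s<k)

slot≤2*⇒< : ∀ {s k} p → slot s p ≤ 2 * k → s < k
slot≤2*⇒< {s} {k} p h =
  *-cancelˡ-< 2 s k (<-≤-trans (n<1+n (2 * s)) (≤-trans (slot-false≤slot s p) h))

suc≡slot : ∀ n → ∃[ s ] ∃[ p ] suc n ≡ slot s p
suc≡slot zero = 0 , false , refl
suc≡slot (suc n) with suc≡slot n
... | s , false , eq = s , true , cong suc eq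
... | s , true  , eq = suc s , false , cong suc (trans eq (sym (*-suc 2 s)))

slot-surjective : ∀ {k} a → 1 ≤ a → a ≤ 2 * k → ∃[ s ] ∃[ p ] (s < k × a ≡ slot s p)
slot-surjective (suc n) _ a≤2k with suc≡slot n
... | s , p , eq = s , p , slot≤2*⇒< p (subst (_≤ _) eq a≤2k) , eq

entry : (ℕ → ℕ) → (ℕ → ℕ) → ℕ → Bool → ℕ
entry i j s false = i (suc s)
entry i j s true  = j (suc s)

σM-slot : ∀ i j s p → σM i j (slot s p) ≡ entry i j s p
σM-slot i j zero false = refl
σM-slot i j zero true  = refl
σM-slot i j (suc s) false =
  trans (cong (σM i j) (slot-suc s false)) (σM-slot (λ t → i (suc t)) (λ t → j (suc t)) s false)
σM-slot i j (suc s) true =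
  trans (cong (σM i j) (slot-suc s true)) (σM-slot (λ t → i (suc t)) (λ t → j (suc t)) s true)

-- `does (x ≟ y)` computes to `x ≡ᵇ y`, the test performed by τM.
τM-suc-other : ∀ m i j x → x ≢ i (suc m) → x ≢ j (suc m) → τM (suc m) i j x ≡ τM m i j x
τM-suc-other m i j x x≢i x≢j
  rewrite dec-false (x ≟ i (suc m)) x≢i | dec-false (x ≟ j (suc m)) x≢j = refl

τM-suc-swap : ∀ m i j p → i (suc m) ≢ j (suc m) → τM (suc m) i j (entry i j m p) ≡ entry i j m (not p)
τM-suc-swap m i j false _ rewrite dec-true (i (suc m) ≟ i (suc m)) refl = refl
τM-suc-swap m i j true i≢j
  rewrite dec-false (j (suc m) ≟ i (suc m)) (i≢j ∘ sym) | dec-true (j (suc m) ≟ j (suc m)) refl = refl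

<-both-entries⇒<-i : ∀ i j t q {x} → x < entry i j t q → x < entry i j t (not q) → x < i (suc t)
<-both-entries⇒<-i i j t false x<i _ = x<i
<-both-entries⇒<-i i j t true  _ x<i = x<i

entry-not-between : ∀ i j s q → ¬ (i (suc s) < entry i j s q × entry i j s q < j (suc s))
entry-not-between i j s false (i<i , _) = <-irrefl refl i<i
entry-not-between i j s true  (_ , j<j) = <-irrefl refl j<j

module SortedPerfectMatching {k : ℕ} {i j : ℕ → ℕ} (M : IsSortedPerfectMatching k i j) where
  open IsSortedPerfectMatching M

  i<j : ∀ {s} → s < k → i (suc s) < j (suc s)
  i<j s<k = proj₁ (proj₂ (bounds _ (s≤s z≤n) s<k))

  1≤i : ∀ {s} → s < k → 1 ≤ i (suc s)
  1≤i s<k = proj₁ (bounds _ (s≤s z≤n) s<k)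

  i-<-mono : ∀ {s t} → s < t → t < k → i (suc s) < i (suc t)
  i-<-mono s<t t<k = increasing _ _ (s≤s z≤n) t<k (s≤s s<t)

  i≤entry : ∀ {s} p → s < k → i (suc s) ≤ entry i j s p
  i≤entry false _   = ≤-refl
  i≤entry true  s<k = <⇒≤ (i<j s<k)

  i<entry : ∀ {s t} q → s < t → t < k → i (suc s) < entry i j t q
  i<entry q s<t t<k = <-≤-trans (i-<-mono s<t t<k) (i≤entry q t<k)

  entry≤2k : ∀ {s} p → s < k → entry i j s p ≤ 2 * k
  entry≤2k true  s<k = proj₂ (proj₂ (bounds _ (s≤s z≤n) s<k))
  entry≤2k false s<k = ≤-trans (<⇒≤ (i<j s<k)) (entry≤2k true s<k)

  entry-injective : ∀ {s t} p q → s < k → t < k → entry i j s p ≡ entry i j t q → s ≡ t × p ≡ q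
  entry-injective false false s<k t<k eq with <-cmp _ _
  ... | tri< s<t _ _ = ⊥-elim (<⇒≢ (i-<-mono s<t t<k) eq)
  ... | tri≈ _ s≡t _ = s≡t , refl
  ... | tri> _ _ t<s = ⊥-elim (<⇒≢ (i-<-mono t<s s<k) (sym eq))
  entry-injective {s} {t} true true s<k t<k eq with s ≟ t
  ... | yes s≡t = s≡t , refl
  ... | no s≢t = ⊥-elim (disjoint-jj _ _ (s≤s z≤n) s<k (s≤s z≤n) t<k (s≢t ∘ suc-injective) eq)
  entry-injective false true s<k t<k eq =
    ⊥-elim (disjoint-ij _ _ (s≤s z≤n) s<k (s≤s z≤n) t<k eq)
  entry-injective true false s<k t<k eq =
    ⊥-elim (disjoint-ij _ _ (s≤s z≤n) t<k (s≤s z≤n) s<k (sym eq))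

  entry-surjective : ∀ x → 1 ≤ x → x ≤ 2 * k → ∃[ s ] ∃[ p ] (s < k × x ≡ entry i j s p)
  entry-surjective x 1≤x x≤2k with covering x 1≤x x≤2k
  ... | suc s , _ , s<k , inj₁ x≡i = s , false , s<k , x≡i
  ... | suc s , _ , s<k , inj₂ x≡j = s , true  , s<k , x≡j

  τM-entry-below : ∀ m → m ≤ k → ∀ {s} p → s < m → τM m i j (entry i j s p) ≡ entry i j s (not p)
  τM-entry-below zero    _   _ ()
  τM-entry-below (suc m) m<k {s} p s<1+m with s ≟ m
  ... | yes refl = τM-suc-swap m i j p (<⇒≢ (i<j m<k))
  ... | no s≢m = begin
    τM (suc m) i j (entry i j s p) ≡⟨ τM-suc-other m i j _ (differs false) (differs true) ⟩
    τM m i j (entry i j s p)       ≡⟨ τM-entry-below m (<⇒≤ m<k) p s<m ⟩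
    entry i j s (not p)            ∎
    where
    open ≡-Reasoning
    s<m = ≤∧≢⇒< (s≤s⁻¹ s<1+m) s≢m
    differs : ∀ q → entry i j s p ≢ entry i j m q
    differs q eq = s≢m (proj₁ (entry-injective p q (<-trans s<m m<k) m<k eq))

  τM-entry : ∀ {s} p → s < k → τM k i j (entry i j s p) ≡ entry i j s (not p)
  τM-entry p = τM-entry-below k ≤-refl p

  record Crossing (s t : ℕ) (q : Bool) : Set where
    constructor crossing
    field
      s<t     : s < t
      t<k     : t < k
      entry<j : entry i j t q < j (suc s)

  crossing⇒InI : ∀ {s t q} → Crossing s t q → InI k i j (slot s true) (slot t q)
  crossing⇒InI {s} {t} {q} (crossing s<t t<k x<j) =
    s≤s z≤n , slot-<-mono true q s<t , <⇒slot≤2* q t<k ,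
    subst₂ _<_ (sym (σM-slot i j t q)) (sym (σM-slot i j s true)) x<j

  crossing⇒InD : ∀ {s t q} → Crossing s t q → InD k i j (i (suc s)) (entry i j t q)
  crossing⇒InD {s} {t} {q} (crossing s<t t<k x<j) =
    1≤i s<k , i<entry q s<t t<k , entry≤2k q t<k ,
    subst (entry i j t q <_) (sym (τM-entry false s<k)) x<j ,
    subst (i (suc s) <_) (sym (τM-entry q t<k)) (i<entry (not q) s<t t<k)
    where s<k = <-trans s<t t<k

  InI⇒crossing : ∀ {a b} → InI k i j a b →
                 ∃[ s ] ∃[ t ] ∃[ q ] (Crossing s t q × a ≡ slot s true × b ≡ slot t q)
  InI⇒crossing (1≤a , a<b , b≤2k , σb<σa)
    with slot-surjective {k} _ 1≤a (<⇒≤ (<-≤-trans a<b b≤2k))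
       | slot-surjective {k} _ (≤-trans 1≤a (<⇒≤ a<b)) b≤2k
  ... | s , p , s<k , refl | t , q , t<k , refl
    with slot-<⁻¹ p q a<b | subst₂ _<_ (σM-slot i j t q) (σM-slot i j s p) σb<σa
  ... | inj₂ (refl , refl , refl) | j<i = ⊥-elim (<-asym j<i (i<j s<k))
  ... | inj₁ s<t | σb<σa with p
  ...   | false = ⊥-elim (<-asym σb<σa (i<entry q s<t t<k))
  ...   | true  = s , t , q , crossing s<t t<k σb<σa , refl , refl

  InD⇒crossing : ∀ {c d} → InD k i j c d →
                 ∃[ s ] ∃[ t ] ∃[ q ] (Crossing s t q × c ≡ i (suc s) × d ≡ entry i j t q)
  InD⇒crossing (1≤c , c<d , d≤2k , d<τc , c<τd)
    with entry-surjective _ 1≤c (<⇒≤ (<-≤-trans c<d d≤2k))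
       | entry-surjective _ (≤-trans 1≤c (<⇒≤ c<d)) d≤2k
  ... | s , p , s<k , refl | t , q , t<k , refl
    with p | subst (entry i j t q <_) (τM-entry p s<k) d<τc
           | subst (entry i j s p <_) (τM-entry q t<k) c<τd
  ... | true  | d<i | _ = ⊥-elim (<-asym d<i (<-trans (i<j s<k) c<d))
  ... | false | d<j | c<τd with <-cmp s t
  ...   | tri< s<t _ _ = s , t , q , crossing s<t t<k d<j , refl , refl
  ...   | tri≈ _ refl _ = ⊥-elim (entry-not-between i j s q (c<d , d<j))
  ...   | tri> _ _ t<s = ⊥-elim (<-asym (i-<-mono t<s s<k) (<-both-entries⇒<-i i j t q c<d c<τd))

  ψM-crossing : ∀ {s t q} → Crossing s t q →
                ψM k i j (slot s true , slot t q) ≡ (i (suc s) , entry i j t q)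
  ψM-crossing {s} {t} {q} (crossing s<t t<k _) = cong₂ _,_
    (trans (cong (τM k i j) (σM-slot i j s true)) (τM-entry true (<-trans s<t t<k)))
    (σM-slot i j t q)

  ψM-crossing-injective : ∀ {s t q s' t' q'} → Crossing s t q → Crossing s' t' q' →
                          (i (suc s) , entry i j t q) ≡ (i (suc s') , entry i j t' q') →
                          s ≡ s' × t ≡ t' × q ≡ q'
  ψM-crossing-injective (crossing s<t t<k _) (crossing s'<t' t'<k _) eq
    with entry-injective false false (<-trans s<t t<k) (<-trans s'<t' t'<k) (cong proj₁ eq)
       | entry-injective _ _ t<k t'<k (cong proj₂ eq)
  ... | s≡s' , _ | t≡t' , q≡q' = s≡s' , t≡t' , q≡q'

lemma3p9 : (k : ℕ) → 2 ≤ k → (i j : ℕ → ℕ) → IsSortedPerfectMatching k i j →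
    ((a b : ℕ) → InI k i j a b →
        InD k i j (proj₁ (ψM k i j (a , b))) (proj₂ (ψM k i j (a , b))))
  × ((a b a' b' : ℕ) → InI k i j a b → InI k i j a' b' →
        ψM k i j (a , b) ≡ ψM k i j (a' , b') → (a , b) ≡ (a' , b'))
  × ((c d : ℕ) → InD k i j c d →
        ∃[ a ] ∃[ b ] (InI k i j a b × ψM k i j (a , b) ≡ (c , d)))
lemma3p9 k _ i j M = maps-into , injective , surjective
  where
  open SortedPerfectMatching M

  maps-into : ∀ a b → InI k i j a b → uncurry (InD k i j) (ψM k i j (a , b))
  maps-into a b ab with InI⇒crossing ab
  ... | _ , _ , _ , cr , refl , refl =
    subst (uncurry (InD k i j)) (sym (ψM-crossing cr)) (crossing⇒InD cr)

  injective : ∀ a b a' b' → InI k i j a b → InI k i j a' b' →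
              ψM k i j (a , b) ≡ ψM k i j (a' , b') → (a , b) ≡ (a' , b')
  injective a b a' b' ab a'b' ψ≡ with InI⇒crossing ab | InI⇒crossing a'b'
  ... | _ , _ , _ , cr , refl , refl | _ , _ , _ , cr' , refl , refl
    with ψM-crossing-injective cr cr' (trans (sym (ψM-crossing cr)) (trans ψ≡ (ψM-crossing cr')))
  ... | refl , refl , refl = refl

  surjective : ∀ c d → InD k i j c d →
               ∃[ a ] ∃[ b ] (InI k i j a b × ψM k i j (a , b) ≡ (c , d))
  surjective c d cd with InD⇒crossing cd
  ... | s , t , q , cr , refl , refl = slot s true , slot t q , crossing⇒InI cr , ψM-crossing cr
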